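{- Let $n\in\mathbb{N}$, let $\mathfrak{H}$ be a CFI-graph over the $n$-dimensional hypercube $\mathcal{H}_n$ with edge set $E_n$, and let $\mu\in\mathrm{HF}(\widehat{E}_n)$. Let $S\subseteq E_n$ be a smallest CFI-support of $\mu$. Then there exists an $\mathrm{Aut}(\mathfrak{H})$-support of $\mu$ of size at most $|S|+n$.
   Context: $\mathcal{H}_n$ has vertex set $\{0,1\}^n$, two strings adjacent iff they differ in exactly one position; $E_n$ is its edge set. CFI construction over $G=(V,E)$: $\widehat{E}=\{e_0,e_1\mid e\in E\}$; for $S'\subseteq V$ the CFI-graph $\mathfrak{G}^{S'}$ has vertex set $\widehat{E}$ together with vertices $v^X$ ($v\in V$, $X\subseteq E(v)$, $|X|$ even if $v\notin S'$, odd if $v\in S'$), and edges $\{e_0,e_1\}$ and $\{v^X,e_i\}$ for $e\in E(v)$, $i=|X\cap\{e\}|$. A CFI-graph over $\mathcal{H}_n$ is such a graph with $G=\mathcal{H}_n$. For $F\subseteq E$, the edge flip $\rho_F$ swaps $e_0,e_1$ for every $e\in F$ and fixes the other elements of $\widehat{E}$. Hereditarily finite sets over $\widehat{E}$: $\mathrm{HF}_0=\widehat{E}\cup\{\emptyset\}$, $\mathrm{HF}_{i+1}=\mathrm{HF}_i\cup 2^{\mathrm{HF}_i}$, $\mathrm{HF}(\widehat{E})=\bigcup_i\mathrm{HF}_i$. A permutation $\rho$ of $\widehat{E}$ acts on $\mathrm{HF}(\widehat{E})$ by renaming atoms: $\rho(x)=\{\rho(y)\mid y\in x\}$. A CFI-support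 of $\mu$ is a set $S\subseteq E_n$ such that every $\rho_F$ ($F\subseteq E_n$) with $F\cap S=\emptyset$ satisfies $\rho_F(\mu)=\mu$. $\mathrm{Aut}(\mathfrak{H})$ is the group of automorphisms of the graph $\mathfrak{H}$ mapping $\widehat{E}_n$ onto itself, acting on $\mathrm{HF}(\widehat{E}_n)$ via their restriction to $\widehat{E}_n$. An $\mathrm{Aut}(\mathfrak{H})$-support of $\mu$ is a set $T$ of vertices of $\mathfrak{H}$ such that every automorphism in $\mathrm{Aut}(\mathfrak{H})$ fixing each element of $T$ fixes $\mu$. -}

module Defs where

open import Data.Nat using (ℕ; _+_; _%_; _≤_)
open import Data.Bool using (Bool; true; false; if_then_else_; _xor_)
open import Data.Fin using (Fin)
open import Data.Vec using (Vec; lookup; _[_]≔_)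
open import Data.Vec.Properties using (lookup∘update)
open import Data.List using (List; []; _∷_; length; map; allFin)
open import Data.Nat.ListAction using (sum)
open import Data.List.Membership.Propositional using (_∈_)
open import Data.List.Relation.Unary.Unique.Propositional using (Unique)
open import Data.Product using (Σ; Σ-syntax; _×_; _,_)
open import Data.Sum using (_⊎_; inj₁; inj₂)
open import Data.Empty using (⊥)
open import Data.Unit using (⊤)
open import Function.Bundles using (_↔_; Inverse)
open import Relation.Binary.PropositionalEquality using (_≡_)

HVertex : ℕ → Set
HVertex n = Vec Bool n

-- Edges: an edge {u, u'} where u, u' differ exactly in coordinate i is
-- represented canonically by the pair (i , w), where w is the endpoint
-- whose i-th coordinate is 0 (false).  This is a bijection with E_n.
HEdge : ℕ → Set
HEdge n = Σ[ iw ∈ (Fin n × Vec Bool n) ] (lookup (Data.Product.proj₂ iw) (Data.Product.proj₁ iw) ≡ false)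

edgeAt : ∀ {n} → HVertex n → Fin n → HEdge n
edgeAt v i = (i , (v [ i ]≔ false)) , lookup∘update i v false

-- Ê_n = { e_0 , e_1 | e ∈ E_n }  (e_b represented as (e , b))
Atom : ℕ → Set
Atom n = HEdge n × Bool

-- cardinality of a subset X of the n edges incident to a vertex;
-- X ⊆ E(v) is encoded by the set of directions of its edges
card : ∀ {n} → (Fin n → Bool) → ℕ
card {n} X = sum (map (λ i → if X i then 1 else 0) (allFin n))

record Gadget (n : ℕ) (S' : HVertex n → Bool) : Set where
  constructor gadget
  field
    vert   : HVertex n
    subset : Fin n → Bool
    parity : card subset % 2 ≡ (if S' vert then 1 else 0)

CFIVertex : (n : ℕ) → (HVertex n → Bool) → Set
CFIVertex n S' = Atom n ⊎ Gadget n S'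

-- one orientation of the edges of 𝔊^{S'}
data CFIArc {n : ℕ} {S' : HVertex n → Bool} : CFIVertex n S' → CFIVertex n S' → Set where
  pairArc   : ∀ e → CFIArc (inj₁ (e , false)) (inj₁ (e , true))
  -- {v^X , e_i} for e ∈ E(v), i = |X ∩ {e}|
  gadgetArc : ∀ (g : Gadget n S') (i : Fin n) →
              CFIArc (inj₂ g) (inj₁ (edgeAt (Gadget.vert g) i , Gadget.subset g i))

CFIAdj : ∀ {n S'} → CFIVertex n S' → CFIVertex n S' → Set
CFIAdj x y = CFIArc x y ⊎ CFIArc y x

data HF (A : Set) : Set where
  atom : A → HF A
  set  : List (HF A) → HF A

mutual
  _≈_ : ∀ {A} → HF A → HF A → Set
  atom a ≈ atom b = a ≡ b
  atom _ ≈ set _  = ⊥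
  set _  ≈ atom _ = ⊥
  set xs ≈ set ys = (xs ⊑ ys) × (ys ⊒ xs)

  _⊑_ : ∀ {A} → List (HF A) → List (HF A) → Set
  []       ⊑ ys = ⊤
  (x ∷ xs) ⊑ ys = (x ∈≈ ys) × (xs ⊑ ys)

  _∈≈_ : ∀ {A} → HF A → List (HF A) → Set
  x ∈≈ []       = ⊥
  x ∈≈ (y ∷ ys) = (x ≈ y) ⊎ (x ∈≈ ys)

  _⊒_ : ∀ {A} → List (HF A) → List (HF A) → Set
  []       ⊒ xs = ⊤
  (y ∷ ys) ⊒ xs = (y ∋≈ xs) × (ys ⊒ xs)

  _∋≈_ : ∀ {A} → HF A → List (HF A) → Set
  y ∋≈ []       = ⊥
  y ∋≈ (x ∷ xs) = (x ≈ y) ⊎ (y ∋≈ xs)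

mutual
  act : ∀ {A} → (A → A) → HF A → HF A
  act ρ (atom a) = atom (ρ a)
  act ρ (set xs) = set (actList ρ xs)

  actList : ∀ {A} → (A → A) → List (HF A) → List (HF A)
  actList ρ []       = []
  actList ρ (x ∷ xs) = act ρ x ∷ actList ρ xs

edgeFlip : ∀ {n} → (HEdge n → Bool) → Atom n → Atom n
edgeFlip F (e , b) = e , (b xor F e)

IsCFISupport : ∀ {n} → List (HEdge n) → HF (Atom n) → Set
IsCFISupport {n} S μ =
  ∀ (F : HEdge n → Bool) → (∀ e → e ∈ S → F e ≡ false) → act (edgeFlip F) μ ≈ μ

-- S is a smallest CFI-support of μ (S duplicate-free, so |S| = length S)
IsSmallestCFISupport : ∀ {n} → List (HEdge n) → HF (Atom n) → Set
IsSmallestCFISupport {n} S μ =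
  Unique S × IsCFISupport S μ ×
  (∀ (S'' : List (HEdge n)) → Unique S'' → IsCFISupport S'' μ → length S ≤ length S'')

record CFIAut (n : ℕ) (S' : HVertex n → Bool) : Set where
  field
    σ          : CFIVertex n S' ↔ CFIVertex n S'
    preserves  : ∀ x y → CFIAdj x y → CFIAdj (Inverse.to σ x) (Inverse.to σ y)
    reflects   : ∀ x y → CFIAdj (Inverse.to σ x) (Inverse.to σ y) → CFIAdj x y
    restr      : Atom n → Atom n
    restr-spec : ∀ a → Inverse.to σ (inj₁ a) ≡ inj₁ (restr a)
    onto       : ∀ a → Σ[ b ∈ Atom n ] (Inverse.to σ (inj₁ b) ≡ inj₁ a)

IsAutSupport : ∀ {n S'} → List (CFIVertex n S') → HF (Atom n) → Set
IsAutSupport {n} {S'} T μ =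
  ∀ (π : CFIAut n S') → (∀ t → t ∈ T → Inverse.to (CFIAut.σ π) t ≡ t) →
  act (CFIAut.restr π) μ ≈ μ

{-# OPTIONS --safe #-}

-- Take T to be the 0-atoms of the edges in S together with the 0-atoms of the
-- n edges at the origin.  An automorphism π of the CFI graph maps pair edges
-- {e₀,e₁} to pair edges, so on Ê it is (e , b) ↦ (f e , b xor φ e) for a
-- permutation f of E_n and a twist φ; since gadget vertices go to gadget
-- vertices, f maps the star of every hypercube vertex into a single star.
-- Such an f that fixes one star pointwise fixes, by a local argument on the
-- squares of the hypercube, the star of every neighbour, hence f = id.  Then π
-- acts on Ê as the edge flip ρ_φ, and φ vanishes on S because π fixes the
-- 0-atoms of S; as S is a CFI-support, π fixes μ.
module Submission where

open import Defs
open import Axiom.UniquenessOfIdentityProofs using (module Decidable⇒UIP)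
open import Data.Bool using (Bool; true; false; not; _xor_; if_then_else_)
import Data.Bool as Bool
open import Data.Bool.Properties using (not-¬; ¬-not; xor-assoc; xor-same; xor-identityʳ)
open import Data.Empty using (⊥-elim)
open import Data.Fin using (Fin; zero; suc; _≟_)
open import Data.List using (List; []; _∷_; length; map; tabulate; _++_)
open import Data.List.Membership.Propositional using (_∈_)
open import Data.List.Membership.Propositional.Properties
  using (∈-map⁺; ∈-++⁺ˡ; ∈-++⁺ʳ; ∈-tabulate⁺)
open import Data.List.Properties using (length-map; length-++; length-tabulate; map-tabulate)
open import Data.Nat using (ℕ; zero; suc; _+_; _≤_; _%_)
open import Data.Nat.ListAction using (sum)
open import Data.Nat.Properties using (≤-reflexive)
open import Data.Product using (Σ-syntax; _×_; _,_; proj₁; proj₂)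
open import Data.Sum using (_⊎_; inj₁; inj₂)
open import Data.Sum.Properties using (inj₁-injective)
open import Data.Vec using ([]; _∷_; lookup; _[_]≔_; replicate)
import Data.Vec.Properties as Vec
open import Data.Vec.Relation.Binary.Pointwise.Extensional using (ext; Pointwise-≡⇒≡)
open import Function.Bundles using (Inverse; Injection)
open import Function.Definitions using (Injective)
open import Function.Properties.Inverse using (↔⇒↣)
open import Relation.Binary.PropositionalEquality
open import Relation.Nullary using (¬_; yes; no)

origin : ∀ n → HVertex n
origin n = replicate n false

flipAt : ∀ {n} → HVertex n → Fin n → HVertex n
flipAt v i = v [ i ]≔ not (lookup v i)

AgreeOff : ∀ {n} → HVertex n → HVertex n → Fin n → Set
AgreeOff a b j = ∀ p → p ≢ j → lookup a p ≡ lookup b p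

lookup-flipAt : ∀ {n} (v : HVertex n) i → lookup (flipAt v i) i ≡ not (lookup v i)
lookup-flipAt v i = Vec.lookup∘update i v _

lookup-flipAt′ : ∀ {n} (v : HVertex n) {i p} → p ≢ i → lookup (flipAt v i) p ≡ lookup v p
lookup-flipAt′ v p≢i = Vec.lookup∘update′ p≢i v _

flipAt-agreeOff : ∀ {n} (v : HVertex n) i → AgreeOff (flipAt v i) v i
flipAt-agreeOff v i p = lookup-flipAt′ v

agreeOff-sym : ∀ {n} {a b : HVertex n} {j} → AgreeOff a b j → AgreeOff b a j
agreeOff-sym agree p p≢j = sym (agree p p≢j)

flipAt-preserves-agreeOff : ∀ {n} {a b : HVertex n} {i j} → j ≢ i →
                            AgreeOff a b i → AgreeOff (flipAt a j) (flipAt b j) i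
flipAt-preserves-agreeOff {a = a} {b} {i} {j} j≢i agree p p≢i with p ≟ j
... | yes refl = trans (lookup-flipAt a p) (trans (cong not (agree p p≢i)) (sym (lookup-flipAt b p)))
... | no p≢j = trans (lookup-flipAt′ a p≢j) (trans (agree p p≢i) (sym (lookup-flipAt′ b p≢j)))

flipAt-changes : ∀ {n} (v : HVertex n) i → lookup (flipAt v i) i ≢ lookup v i
flipAt-changes v i eq = not-¬ refl (sym (trans (sym (lookup-flipAt v i)) eq))

flipAt-differ : ∀ {n} (v : HVertex n) {i j} → i ≢ j → lookup (flipAt v i) i ≢ lookup (flipAt v j) i
flipAt-differ v {i} i≢j eq = flipAt-changes v i (trans eq (lookup-flipAt′ v i≢j))

¬agreeOff-diagonal : ∀ {n} (v y : HVertex n) {i j k k′} → i ≢ j → k ≢ i → k ≢ j →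
                     AgreeOff (flipAt v i) y k → ¬ AgreeOff (flipAt v j) y k′
¬agreeOff-diagonal v y {i} {j} {k} {k′} i≢j k≢i k≢j agree-i agree-j with j ≟ k′
... | no j≢k′ = flipAt-differ v (≢-sym i≢j) (sym (both j (≢-sym k≢j) j≢k′))
  where
  both : ∀ p → p ≢ k → p ≢ k′ → lookup (flipAt v i) p ≡ lookup (flipAt v j) p
  both p p≢k p≢k′ = trans (agree-i p p≢k) (sym (agree-j p p≢k′))
... | yes refl = flipAt-differ v i≢j (trans (agree-i i (≢-sym k≢i)) (sym (agree-j i i≢j)))

agreeOff⇒≡⊎flipAt : ∀ {n} {a b : HVertex n} {q} → AgreeOff a b q → a ≡ b ⊎ a ≡ flipAt b q
agreeOff⇒≡⊎flipAt {a = a} {b} {q} agree with lookup a q Bool.≟ lookup b q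
... | yes same = inj₁ (Pointwise-≡⇒≡ (ext at))
  where
  at : ∀ p → lookup a p ≡ lookup b p
  at p with p ≟ q
  ... | yes refl = same
  ... | no p≢q = agree p p≢q
... | no differ = inj₂ (Pointwise-≡⇒≡ (ext at))
  where
  at : ∀ p → lookup a p ≡ lookup (flipAt b q) p
  at p with p ≟ q
  ... | yes refl = trans (¬-not differ) (sym (lookup-flipAt b p))
  ... | no p≢q = trans (agree p p≢q) (sym (lookup-flipAt′ b p≢q))

hypercube-induction : ∀ {n} (P : HVertex n → Set) → P (origin n) →
                      (∀ v i → P v → P (flipAt v i)) → ∀ v → P v
hypercube-induction P base step [] = base
hypercube-induction P base step (false ∷ v) =
  hypercube-induction (λ u → P (false ∷ u)) base (λ u i → step (false ∷ u) (suc i)) v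
hypercube-induction P base step (true ∷ v) =
  step (false ∷ v) zero
    (hypercube-induction (λ u → P (false ∷ u)) base (λ u i → step (false ∷ u) (suc i)) v)

edge-≡ : ∀ {n i} {a b : HVertex n} {pa pb} → a ≡ b →
         _≡_ {A = HEdge n} ((i , a) , pa) ((i , b) , pb)
edge-≡ {pa = pa} {pb} refl = cong (_ ,_) (Decidable⇒UIP.≡-irrelevant Bool._≟_ pa pb)

edgeAt-cong : ∀ {n} {a b : HVertex n} {j} → AgreeOff a b j → edgeAt a j ≡ edgeAt b j
edgeAt-cong {a = a} {b} {j} agree = edge-≡ (Pointwise-≡⇒≡ (ext at))
  where
  at : ∀ p → lookup (a [ j ]≔ false) p ≡ lookup (b [ j ]≔ false) p
  at p with p ≟ j
  ... | yes refl = trans (Vec.lookup∘update p a false) (sym (Vec.lookup∘update p b false))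
  ... | no p≢j = trans (Vec.lookup∘update′ p≢j a false)
                   (trans (agree p p≢j) (sym (Vec.lookup∘update′ p≢j b false)))

edgeAt-injective : ∀ {n} {a b : HVertex n} {j k} → edgeAt a j ≡ edgeAt b k → j ≡ k × AgreeOff a b j
edgeAt-injective {a = a} {b} {j} eq with cong (λ e → proj₁ (proj₁ e)) eq
... | refl = refl , λ p p≢j →
  trans (sym (Vec.lookup∘update′ p≢j a false))
    (trans (cong (λ e → lookup (proj₂ (proj₁ e)) p) eq) (Vec.lookup∘update′ p≢j b false))

edgeAt-flipAt : ∀ {n} (v : HVertex n) i → edgeAt (flipAt v i) i ≡ edgeAt v i
edgeAt-flipAt v i = edgeAt-cong (flipAt-agreeOff v i)

edge-canonical : ∀ {n} (e : HEdge n) → e ≡ edgeAt (proj₂ (proj₁ e)) (proj₁ (proj₁ e))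
edge-canonical ((i , w) , w[i]≡false) =
  edge-≡ (sym (trans (cong (w [ i ]≔_) (sym w[i]≡false)) (Vec.[]≔-lookup w i)))

MapsStar : ∀ {n} → (HEdge n → HEdge n) → HVertex n → HVertex n → Set
MapsStar {n} f v w = ∀ j → Σ[ k ∈ Fin n ] f (edgeAt v j) ≡ edgeAt w k

FixesStar : ∀ {n} → (HEdge n → HEdge n) → HVertex n → Set
FixesStar f v = ∀ j → f (edgeAt v j) ≡ edgeAt v j

module StarRigidity {n} {f : HEdge n → HEdge n} (f-injective : Injective _≡_ _≡_ f)
                    (mapsSomeStar : ∀ v → Σ[ w ∈ HVertex n ] MapsStar f v w) where

  fixesStar-shared-edge : ∀ {v} → FixesStar f v → ∀ i → f (edgeAt (flipAt v i) i) ≡ edgeAt (flipAt v i) i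
  fixesStar-shared-edge {v} fix i =
    trans (cong f (edgeAt-flipAt v i)) (trans (fix i) (sym (edgeAt-flipAt v i)))

  mapsStar-fixedStar⇒agreeOff : ∀ {v w} → FixesStar f v → MapsStar f w v → ∀ j → AgreeOff w v j
  mapsStar-fixedStar⇒agreeOff fix maps j with maps j
  ... | k , e = proj₂ (edgeAt-injective (f-injective (trans e (sym (fix k)))))

  -- f(star (v⊕i)) contains the fixed edge (v, i), so it lies in the star of v or of
  -- v⊕i; not of v, since f fixes star v and is injective while (v⊕i, j) ∉ star v.
  mapsStar-flipAt : ∀ {v i j} → FixesStar f v → j ≢ i → MapsStar f (flipAt v i) (flipAt v i)
  mapsStar-flipAt {v} {i} {j} fix j≢i with mapsSomeStar (flipAt v i)
  ... | w , maps
    with edgeAt-injective (trans (sym (fix i)) (trans (cong f (sym (edgeAt-flipAt v i))) (proj₂ (maps i))))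
  ... | _ , agree with agreeOff⇒≡⊎flipAt {a = w} {b = v} (agreeOff-sym {a = v} {b = w} agree)
  ... | inj₂ refl = maps
  ... | inj₁ refl =
    ⊥-elim (flipAt-changes v i (mapsStar-fixedStar⇒agreeOff fix maps j i (≢-sym j≢i)))

  -- In the square v, v⊕i, v⊕j, y = v⊕i⊕j, f sends (y, j) = (v⊕i, j) into direction k
  -- at v⊕i and (y, i) = (v⊕j, i) into the star of v⊕j; so the vertex y′ with
  -- f(star y) ⊆ star y′ is one k-step from v⊕i and one step from v⊕j, impossible
  -- for k ∉ {i, j}.
  no-twist : ∀ {v i j k} → FixesStar f v → j ≢ i → k ≢ j →
             f (edgeAt (flipAt v i) j) ≢ edgeAt (flipAt v i) k
  no-twist {v} {i} {j} {k} fix j≢i k≢j e =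
    ¬agreeOff-diagonal v y′ (≢-sym j≢i) k≢i k≢j agree-i agree-j
    where
    y = flipAt (flipAt v i) j
    y′ = proj₁ (mapsSomeStar y)
    maps-y : MapsStar f y y′
    maps-y = proj₂ (mapsSomeStar y)
    maps-j : MapsStar f (flipAt v j) (flipAt v j)
    maps-j = mapsStar-flipAt fix (≢-sym j≢i)

    k≢i : k ≢ i
    k≢i refl = j≢i (proj₁ (edgeAt-injective (f-injective (trans e (sym (fixesStar-shared-edge fix k))))))

    agree-i : AgreeOff (flipAt v i) y′ k
    agree-i = proj₂ (edgeAt-injective
      (trans (sym e) (trans (cong f (sym (edgeAt-flipAt (flipAt v i) j))) (proj₂ (maps-y j)))))

    y-near-flipAt-j : AgreeOff y (flipAt v j) i
    y-near-flipAt-j = flipAt-preserves-agreeOff {a = flipAt v i} {b = v} j≢i (flipAt-agreeOff v i)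

    agree-j : AgreeOff (flipAt v j) y′ (proj₁ (maps-j i))
    agree-j = proj₂ (edgeAt-injective
      (trans (sym (proj₂ (maps-j i))) (trans (cong f (sym (edgeAt-cong y-near-flipAt-j))) (proj₂ (maps-y i)))))

  fixesStar-flipAt : ∀ {v i} → FixesStar f v → FixesStar f (flipAt v i)
  fixesStar-flipAt {v} {i} fix j with j ≟ i
  ... | yes refl = fixesStar-shared-edge fix j
  ... | no j≢i with mapsStar-flipAt fix j≢i j
  ... | k , e with k ≟ j
  ... | yes refl = e
  ... | no k≢j = ⊥-elim (no-twist fix j≢i k≢j e)

  fixesStar-origin⇒≗id : FixesStar f (origin n) → ∀ e → f e ≡ e
  fixesStar-origin⇒≗id fix e =
    trans (cong f (edge-canonical e))
      (trans (hypercube-induction (FixesStar f) fix (λ _ _ → fixesStar-flipAt) _ _)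
        (sym (edge-canonical e)))

partner : ∀ {n} → Atom n → Atom n
partner (e , b) = e , not b

adjacent-atoms : ∀ {n S'} {a b : Atom n} → CFIAdj {n} {S'} (inj₁ a) (inj₁ b) → b ≡ partner a
adjacent-atoms (inj₁ (pairArc e)) = refl
adjacent-atoms (inj₂ (pairArc e)) = refl

gadget-neighbour : ∀ {n S'} {g : Gadget n S'} {a : Atom n} → CFIAdj (inj₂ g) (inj₁ a) →
                   Σ[ k ∈ Fin n ] proj₁ a ≡ edgeAt (Gadget.vert g) k
gadget-neighbour (inj₁ (gadgetArc g k)) = k , refl

module AutOnEdges {n S'} (π : CFIAut n S') where
  open CFIAut π

  σ-injective : Injective _≡_ _≡_ (Inverse.to σ)
  σ-injective = Injection.injective (↔⇒↣ σ)

  restr-injective : Injective _≡_ _≡_ restr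
  restr-injective {a} {b} eq =
    inj₁-injective (σ-injective (trans (restr-spec a) (trans (cong inj₁ eq) (sym (restr-spec b)))))

  restr-fixes : ∀ a → Inverse.to σ (inj₁ a) ≡ inj₁ a → restr a ≡ a
  restr-fixes a fixed = inj₁-injective (trans (sym (restr-spec a)) fixed)

  edgeMap : HEdge n → HEdge n
  edgeMap e = proj₁ (restr (e , false))

  twist : HEdge n → Bool
  twist e = proj₂ (restr (e , false))

  restr-≡ : ∀ e b → restr (e , b) ≡ (edgeMap e , b xor twist e)
  restr-≡ e false = refl
  restr-≡ e true = adjacent-atoms (subst₂ CFIAdj (restr-spec (e , false)) (restr-spec (e , true))
                                    (preserves _ _ (inj₁ (pairArc e))))

  edgeMap-injective : Injective _≡_ _≡_ edgeMap
  edgeMap-injective {e} {e′} eq = cong proj₁ (restr-injective (begin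
    restr (e , false)                                   ≡⟨ cong₂ _,_ eq (sym xor-cancel) ⟩
    (edgeMap e′ , (twist e xor twist e′) xor twist e′)  ≡⟨ sym (restr-≡ e′ _) ⟩
    restr (e′ , twist e xor twist e′)                   ∎))
    where
    open ≡-Reasoning
    xor-cancel : (twist e xor twist e′) xor twist e′ ≡ twist e
    xor-cancel = trans (xor-assoc (twist e) _ _)
                   (trans (cong (twist e xor_) (xor-same (twist e′))) (xor-identityʳ (twist e)))

  gadget-image : ∀ g → Σ[ g′ ∈ Gadget n S' ] Inverse.to σ (inj₂ g) ≡ inj₂ g′
  gadget-image g with Inverse.to σ (inj₂ g) in eq
  ... | inj₂ g′ = g′ , refl
  ... | inj₁ a with onto a
  ...   | b , σb≡a with σ-injective (trans σb≡a (sym eq))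
  ...     | ()

  gadget-mapsStar : (g : Gadget n S') → Σ[ w ∈ HVertex n ] MapsStar edgeMap (Gadget.vert g) w
  gadget-mapsStar g with gadget-image g
  ... | g′ , σg≡g′ = Gadget.vert g′ , λ j →
    let a = edgeAt (Gadget.vert g) j , Gadget.subset g j
        (k , eq) = gadget-neighbour (subst₂ CFIAdj σg≡g′ (restr-spec a) (preserves _ _ (inj₁ (gadgetArc g j))))
    in k , trans (sym (cong proj₁ (restr-≡ _ _))) eq

firstIf : ∀ {m} → Bool → Fin (suc m) → Bool
firstIf b zero = b
firstIf b (suc _) = false

sum-tabulate-zero : ∀ m → sum (tabulate {n = m} (λ _ → 0)) ≡ 0
sum-tabulate-zero zero = refl
sum-tabulate-zero (suc m) = sum-tabulate-zero m

card-firstIf : ∀ {m} b → card {suc m} (firstIf b) ≡ (if b then 1 else 0) + 0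
card-firstIf {m} b =
  cong ((if b then 1 else 0) +_)
    (trans (cong sum (map-tabulate {n = m} suc (λ i → if firstIf b i then 1 else 0)))
      (sum-tabulate-zero m))

someGadget : ∀ {m} (S' : HVertex (suc m) → Bool) (v : HVertex (suc m)) → Gadget (suc m) S'
someGadget {m} S' v = gadget v (firstIf (S' v)) (parity (S' v))
  where
  parity : ∀ b → card {suc m} (firstIf b) % 2 ≡ (if b then 1 else 0)
  parity true = cong (_% 2) (card-firstIf {m} true)
  parity false = cong (_% 2) (card-firstIf {m} false)

edgeMap-mapsSomeStar : ∀ {n S'} (π : CFIAut n S') v →
                       Σ[ w ∈ HVertex n ] MapsStar (AutOnEdges.edgeMap π) v w
edgeMap-mapsSomeStar {zero} π v = v , λ ()
edgeMap-mapsSomeStar {suc m} {S'} π v = AutOnEdges.gadget-mapsStar π (someGadget S' v)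

restr≗edgeFlip : ∀ {n S'} (π : CFIAut n S') → FixesStar (AutOnEdges.edgeMap π) (origin n) →
                 ∀ a → CFIAut.restr π a ≡ edgeFlip (AutOnEdges.twist π) a
restr≗edgeFlip π fix (e , b) =
  trans (restr-≡ e b) (cong (_, b xor twist e) (fixesStar-origin⇒≗id fix e))
  where
  open AutOnEdges π
  open StarRigidity edgeMap-injective (edgeMap-mapsSomeStar π)

mutual
  act-cong : ∀ {A} {ρ ρ′ : A → A} → (∀ a → ρ a ≡ ρ′ a) → ∀ μ → act ρ μ ≡ act ρ′ μ
  act-cong ρ≗ρ′ (atom a) = cong atom (ρ≗ρ′ a)
  act-cong ρ≗ρ′ (set xs) = cong set (actList-cong ρ≗ρ′ xs)

  actList-cong : ∀ {A} {ρ ρ′ : A → A} → (∀ a → ρ a ≡ ρ′ a) → ∀ xs → actList ρ xs ≡ actList ρ′ xs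
  actList-cong ρ≗ρ′ [] = refl
  actList-cong ρ≗ρ′ (x ∷ xs) = cong₂ _∷_ (act-cong ρ≗ρ′ x) (actList-cong ρ≗ρ′ xs)

lemma7p4 : (n : ℕ) (S' : HVertex n → Bool) (μ : HF (Atom n)) (S : List (HEdge n)) →
           IsSmallestCFISupport S μ →
           Σ[ T ∈ List (CFIVertex n S') ] (length T ≤ length S + n × IsAutSupport T μ)
lemma7p4 n S' μ S (_ , S-supports , _) = T , length-T , T-supports
  where
  zeroAtom : HEdge n → CFIVertex n S'
  zeroAtom e = inj₁ (e , false)

  originStar : List (HEdge n)
  originStar = tabulate (edgeAt (origin n))

  T : List (CFIVertex n S')
  T = map zeroAtom (S ++ originStar)

  length-T : length T ≤ length S + n
  length-T = ≤-reflexive (trans (length-map zeroAtom (S ++ originStar))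
                           (trans (length-++ S) (cong (length S +_) (length-tabulate _))))

  T-supports : IsAutSupport T μ
  T-supports π fixes-T =
    subst (_≈ μ) (sym (act-cong (restr≗edgeFlip π fixes-origin) μ)) (S-supports twist twist-vanishes)
    where
    open AutOnEdges π
    fixes : ∀ e → e ∈ S ++ originStar → CFIAut.restr π (e , false) ≡ (e , false)
    fixes e mem = restr-fixes _ (fixes-T _ (∈-map⁺ zeroAtom mem))

    fixes-origin : FixesStar edgeMap (origin n)
    fixes-origin j = cong proj₁ (fixes _ (∈-++⁺ʳ S (∈-tabulate⁺ j)))

    twist-vanishes : ∀ e → e ∈ S → twist e ≡ false
    twist-vanishes e mem = cong proj₂ (fixes e (∈-++⁺ˡ mem))
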